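{- Let $n\ge 2$ be an integer and let $m\in\{n-1,n\}$. Then \[ \sum_{k=0}^{m}\frac{\bigl(n(n-2)\bigr)^k}{k!} \ \le\ m!\left(\sum_{k=0}^{m}\frac{(-n)^k}{k!}\right)^2. \] -}

module Defs where

open import Data.Nat using (ℕ; zero; suc; _!)
open import Data.Nat.Properties using (_!≢0)
open import Data.Integer using (ℤ) renaming (_^_ to _^ℤ_)
open import Data.Rational using (ℚ; _+_; _/_)

sumTo : ℕ → (ℕ → ℚ) → ℚ
sumTo zero    f = f zero
sumTo (suc m) f = sumTo m f + f (suc m)

expTrunc : ℕ → ℤ → ℚ
expTrunc m x = sumTo m (λ k → _/_ (x ^ℤ k) (k !) {{k !≢0}})

{-# OPTIONS --safe #-}
module Submission where

-- Multiplied by m !, the inequality reads S_m(n (n - 2)) ≤ S_m(- n)² for the integers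
-- S_m(x) = m! Σ_{k ≤ m} x^k / k!, which satisfy S_{m+1}(x) = x^{m+1} + (m + 1) S_m(x).
-- For y > m the terms of S_m(y) decay at least geometrically with ratio m / y, whence
-- (y - m) S_m(y) ≤ y^{m+1}. For m ≤ n the numbers g_m = |S_m(- n)| satisfy
-- g_{m+1} = n^{m+1} - (m + 1) g_m, and an induction keeps g_m / n^m between (n - 1)/(n - 1 + m)
-- and n/(n + m). Together with (1 - 2/n)^n < 1/5, which follows from the first three
-- terms of the binomial expansion of (a + 2)^n for a = n - 2, this reduces the inequality to a
-- polynomial one in n, valid for n ≥ 4 when m = n and for n ≥ 6 when m = n - 1; the remaining
-- cases are evaluated.

module TruncatedBinomial where
  open import Data.Nat
  open import Data.Nat.Properties
  open import Data.Nat.Combinatorics using (_C_; nC1≡n; nCk+nC[k+1]≡[n+1]C[k+1])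
  open import Data.Nat.Tactic.RingSolver using (solve-∀)
  open import Relation.Binary.PropositionalEquality

  -- a ^ (k ∸ 2) * binomialHead a b k are the first three terms of the expansion of (a + b) ^ k
  binomialHead : ℕ → ℕ → ℕ → ℕ
  binomialHead a b k = a * a + k * a * b + (k C 2) * (b * b)

  binomialHead-suc : ∀ a b k →
    a * binomialHead a b (suc k) + (k C 2) * (b * (b * b)) ≡ (a + b) * binomialHead a b k
  binomialHead-suc a b k = begin
    a * binomialHead a b (suc k) + (k C 2) * (b * (b * b))
      ≡⟨ cong (λ c → a * (a * a + suc k * a * b + c * (b * b)) + (k C 2) * (b * (b * b))) pascal ⟩
    a * (a * a + suc k * a * b + (k + (k C 2)) * (b * b)) + (k C 2) * (b * (b * b))
      ≡⟨ identity a b k (k C 2) ⟩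
    (a + b) * binomialHead a b k ∎
    where
    open ≡-Reasoning
    pascal : (suc k C 2) ≡ k + (k C 2)
    pascal = trans (sym (nCk+nC[k+1]≡[n+1]C[k+1] k 1)) (cong (_+ (k C 2)) (nC1≡n k))
    identity : ∀ a b k c →
      a * (a * a + suc k * a * b + (k + c) * (b * b)) + c * (b * (b * b)) ≡
        (a + b) * (a * a + k * a * b + c * (b * b))
    identity = solve-∀

  binomialHead-≤ : ∀ a b k → a ^ k * binomialHead a b k ≤ a * a * (a + b) ^ k
  binomialHead-≤ a b zero = ≤-reflexive (identity a b)
    where
    identity : ∀ a b → 1 * (a * a + 0 * a * b + 0 * (b * b)) ≡ a * a * 1
    identity = solve-∀
  binomialHead-≤ a b (suc k) = begin
    a ^ suc k * binomialHead a b (suc k)                 ≤⟨ m≤m+n _ _ ⟩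
    a ^ suc k * binomialHead a b (suc k) + a ^ k * ((k C 2) * (b * (b * b)))
      ≡⟨ factor (a ^ k) a (binomialHead a b (suc k)) ((k C 2) * (b * (b * b))) ⟩
    a ^ k * (a * binomialHead a b (suc k) + (k C 2) * (b * (b * b)))
      ≡⟨ cong (a ^ k *_) (binomialHead-suc a b k) ⟩
    a ^ k * ((a + b) * binomialHead a b k)               ≡⟨ x*[y*z]≡y*[x*z] (a ^ k) (a + b) _ ⟩
    (a + b) * (a ^ k * binomialHead a b k)               ≤⟨ *-monoʳ-≤ (a + b) (binomialHead-≤ a b k) ⟩
    (a + b) * (a * a * (a + b) ^ k)                      ≡⟨ x*[y*z]≡y*[x*z] (a + b) (a * a) _ ⟩
    a * a * (a + b) ^ suc k                              ∎
    where
    open ≤-Reasoning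
    factor : ∀ p a h r → a * p * h + p * r ≡ p * (a * h + r)
    factor = solve-∀
    x*[y*z]≡y*[x*z] : ∀ x y z → x * (y * z) ≡ y * (x * z)
    x*[y*z]≡y*[x*z] = solve-∀

  2*[1+n]C2≡[1+n]*n : ∀ n → 2 * (suc n C 2) ≡ suc n * n
  2*[1+n]C2≡[1+n]*n zero    = refl
  2*[1+n]C2≡[1+n]*n (suc n) = begin
    2 * (suc (suc n) C 2)         ≡⟨ cong (2 *_) (sym (nCk+nC[k+1]≡[n+1]C[k+1] (suc n) 1)) ⟩
    2 * (suc n C 1 + (suc n C 2)) ≡⟨ cong (λ c → 2 * (c + (suc n C 2))) (nC1≡n (suc n)) ⟩
    2 * (suc n + (suc n C 2))     ≡⟨ *-distribˡ-+ 2 (suc n) _ ⟩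
    2 * suc n + 2 * (suc n C 2)   ≡⟨ cong (2 * suc n +_) (2*[1+n]C2≡[1+n]*n n) ⟩
    2 * suc n + suc n * n         ≡⟨ identity n ⟩
    suc (suc n) * suc n           ∎
    where
    open ≡-Reasoning
    identity : ∀ n → 2 * suc n + suc n * n ≡ suc (suc n) * suc n
    identity = solve-∀

  -- With n = 2 + a: (1 - 2/n)^n ≤ a² / (5a² + 10a + 4)
  a^[2+a]-≤ : ∀ a → a ^ (2 + a) * (4 + 10 * a + 5 * (a * a)) ≤ a * a * (2 + a) ^ (2 + a)
  a^[2+a]-≤ a = begin
    a ^ (2 + a) * (4 + 10 * a + 5 * (a * a)) ≡⟨ cong (a ^ (2 + a) *_) head≡ ⟨
    a ^ (2 + a) * binomialHead a 2 (2 + a)   ≤⟨ binomialHead-≤ a 2 (2 + a) ⟩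
    a * a * (a + 2) ^ (2 + a)                ≡⟨ cong (λ n → a * a * n ^ (2 + a)) (+-comm a 2) ⟩
    a * a * (2 + a) ^ (2 + a)                ∎
    where
    open ≤-Reasoning
    head≡ : binomialHead a 2 (2 + a) ≡ 4 + 10 * a + 5 * (a * a)
    head≡ = begin-equality
      a * a + (2 + a) * a * 2 + ((2 + a) C 2) * 4
        ≡⟨ identity₁ a ((2 + a) C 2) ⟩
      a * a + (2 + a) * a * 2 + 2 * (2 * ((2 + a) C 2))
        ≡⟨ cong (λ c → a * a + (2 + a) * a * 2 + 2 * c) (2*[1+n]C2≡[1+n]*n (suc a)) ⟩
      a * a + (2 + a) * a * 2 + 2 * ((2 + a) * (1 + a))
        ≡⟨ identity₂ a ⟩
      4 + 10 * a + 5 * (a * a) ∎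
      where
      identity₁ : ∀ a c → a * a + (2 + a) * a * 2 + c * 4 ≡ a * a + (2 + a) * a * 2 + 2 * (2 * c)
      identity₁ = solve-∀
      identity₂ : ∀ a → a * a + (2 + a) * a * 2 + 2 * ((2 + a) * (1 + a)) ≡ 4 + 10 * a + 5 * (a * a)
      identity₂ = solve-∀

module ScaledExpSums where
  open import Data.Nat
  open import Data.Nat.Properties
  open import Data.Nat.Tactic.RingSolver using (solve-∀)
  open import Data.Product using (_,_)
  open import Relation.Binary.PropositionalEquality

  -- m ! * Σ_{k ≤ m} y ^ k / k !
  scaledExpℕ : ℕ → ℕ → ℕ
  scaledExpℕ y zero    = 1
  scaledExpℕ y (suc m) = y ^ suc m + suc m * scaledExpℕ y m

  scaledExpℕ-≤ : ∀ y m e → m + e ≡ y → scaledExpℕ y m * e ≤ y ^ suc m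
  scaledExpℕ-≤ y zero e refl = ≤-reflexive (trans (*-identityˡ e) (sym (*-identityʳ e)))
  scaledExpℕ-≤ y (suc m) e refl = begin
    (Y + suc m * S) * e      ≡⟨ distrib Y (suc m) S e ⟩
    Y * e + suc m * (S * e)  ≤⟨ +-monoʳ-≤ (Y * e) (*-monoʳ-≤ (suc m) S*e≤Y) ⟩
    Y * e + suc m * Y        ≡⟨ collect Y (suc m) e ⟩
    (suc m + e) * Y          ∎
    where
    open ≤-Reasoning
    Y S : ℕ
    Y = (suc m + e) ^ suc m
    S = scaledExpℕ (suc m + e) m
    S*e≤Y : S * e ≤ Y
    S*e≤Y = ≤-trans (*-monoʳ-≤ S (n≤1+n e)) (scaledExpℕ-≤ (suc m + e) m (suc e) (+-suc m e))
    distrib : ∀ y m s e → (y + m * s) * e ≡ y * e + m * (s * e)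
    distrib = solve-∀
    collect : ∀ y m e → y * e + m * y ≡ (m + e) * y
    collect = solve-∀

  -- For m ≤ n this is (- 1) ^ m * m ! * Σ_{k ≤ m} (- n) ^ k / k !: there the truncated
  -- subtraction never truncates (altScaledExp-recurrence).
  altScaledExp : ℕ → ℕ → ℕ
  altScaledExp n zero    = 1
  altScaledExp n (suc m) = n ^ suc m ∸ suc m * altScaledExp n m

  upper-bound-step : ∀ k m g g′ P .{{_ : NonZero k}} → m ≤ k →
    g′ + suc m * g ≡ suc k * P → k * P ≤ (k + m) * g → (suc k + suc m) * g′ ≤ suc k * (suc k * P)
  upper-bound-step k m g g′ P m≤k rec lower with m≤n⇒∃[o]m+o≡n m≤k
  ... | d , refl = *-cancelˡ-≤ (k + m) {{k+m≢0}} (+-cancelʳ-≤ (suc m * N * (k * P)) _ _ (begin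
    (k + m) * (N * g′) + suc m * N * (k * P)   ≤⟨ +-monoʳ-≤ ((k + m) * (N * g′)) (*-monoʳ-≤ (suc m * N) lower) ⟩
    (k + m) * (N * g′) + suc m * N * ((k + m) * g) ≡⟨ factor (k + m) N g′ (suc m) g ⟩
    (k + m) * N * (g′ + suc m * g)              ≡⟨ cong ((k + m) * N *_) rec ⟩
    (k + m) * N * (suc k * P)                   ≤⟨ m≤m+n _ (suc m * d * P) ⟩
    (k + m) * N * (suc k * P) + suc m * d * P   ≡⟨ identity m d P ⟩
    (k + m) * (suc k * (suc k * P)) + suc m * N * (k * P) ∎))
    where
    open ≤-Reasoning
    N : ℕ
    N = suc k + suc m
    k+m≢0 : NonZero (k + m)
    k+m≢0 = >-nonZero (≤-trans (>-nonZero⁻¹ k) (m≤m+n k m))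
    factor : ∀ c N g′ M g → c * (N * g′) + M * N * (c * g) ≡ c * N * (g′ + M * g)
    factor = solve-∀
    identity : ∀ m d P → let k = m + d ; N = suc k + suc m in
      (k + m) * N * (suc k * P) + suc m * d * P ≡ (k + m) * (suc k * (suc k * P)) + suc m * N * (k * P)
    identity = solve-∀

  lower-bound-step : ∀ k m g g′ P →
    g′ + suc m * g ≡ suc k * P → (suc k + m) * g ≤ suc k * P → k * (suc k * P) ≤ (k + suc m) * g′
  lower-bound-step k m g g′ P rec upper = +-cancelʳ-≤ (suc m * nP) _ _ (begin
    k * nP + suc m * nP                     ≡⟨ *-distribʳ-+ nP k (suc m) ⟨
    (k + suc m) * nP                        ≡⟨ cong ((k + suc m) *_) rec ⟨
    (k + suc m) * (g′ + suc m * g)          ≡⟨ identity k m g g′ ⟩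
    (k + suc m) * g′ + suc m * ((suc k + m) * g) ≤⟨ +-monoʳ-≤ ((k + suc m) * g′) (*-monoʳ-≤ (suc m) upper) ⟩
    (k + suc m) * g′ + suc m * nP           ∎)
    where
    open ≤-Reasoning
    nP : ℕ
    nP = suc k * P
    identity : ∀ k m g g′ → (k + suc m) * (g′ + suc m * g) ≡ (k + suc m) * g′ + suc m * ((suc k + m) * g)
    identity = solve-∀

  -- For n = suc k the two bounds say k / (k + m) ≤ g_m / n ^ m ≤ n / (n + m). As
  -- g_{m+1} / n ^ (m + 1) = 1 - (m + 1) / n * g_m / n ^ m, each bound at m + 1 follows
  -- from the other one at m.
  mutual
    altScaledExp-upper : ∀ k .{{_ : NonZero k}} m → m ≤ suc k →
      (suc k + m) * altScaledExp (suc k) m ≤ suc k ^ suc m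
    altScaledExp-upper k zero _ = ≤-reflexive (cong (_* 1) (+-identityʳ (suc k)))
    altScaledExp-upper k (suc m) 1+m≤n = upper-bound-step k m _ _ _ (≤-pred 1+m≤n)
      (altScaledExp-recurrence k m m≤n) (altScaledExp-lower k m m≤n)
      where
      m≤n : m ≤ suc k
      m≤n = ≤-trans (n≤1+n m) 1+m≤n

    altScaledExp-lower : ∀ k .{{_ : NonZero k}} m → m ≤ suc k →
      k * suc k ^ m ≤ (k + m) * altScaledExp (suc k) m
    altScaledExp-lower k zero _ = ≤-reflexive (cong (_* 1) (sym (+-identityʳ k)))
    altScaledExp-lower k (suc m) 1+m≤n = lower-bound-step k m _ _ _
      (altScaledExp-recurrence k m m≤n) (altScaledExp-upper k m m≤n)
      where
      m≤n : m ≤ suc k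
      m≤n = ≤-trans (n≤1+n m) 1+m≤n

    altScaledExp-recurrence : ∀ k .{{_ : NonZero k}} m → m ≤ suc k →
      altScaledExp (suc k) (suc m) + suc m * altScaledExp (suc k) m ≡ suc k ^ suc m
    altScaledExp-recurrence k m m≤n =
      m∸n+n≡m (≤-trans (*-monoˡ-≤ _ (s≤s (m≤n+m m k))) (altScaledExp-upper k m m≤n))

module MainEstimate where
  open import Data.Nat
  open import Data.Nat.Properties
  open import Data.Nat.Tactic.RingSolver using (solve-∀)
  open import Data.Sum using (_⊎_; inj₁; inj₂)
  open import Relation.Binary.PropositionalEquality
  open TruncatedBinomial
  open ScaledExpSums

  ^-distrib-* : ∀ x y k → (x * y) ^ k ≡ x ^ k * y ^ k
  ^-distrib-* x y zero    = refl
  ^-distrib-* x y (suc k) = trans (cong (x * y *_) (^-distrib-* x y k)) (interchange x y (x ^ k) (y ^ k))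
    where
    interchange : ∀ x y p q → x * y * (p * q) ≡ x * p * (y * q)
    interchange = solve-∀

  scaledExpℕ-[2+a]*a-≤ : ∀ a j e → j + suc a + e ≡ (2 + a) * a →
    scaledExpℕ ((2 + a) * a) (j + suc a) * e * (4 + 10 * a + 5 * (a * a)) ≤
      ((2 + a) * a) ^ j * (a * a) * ((2 + a) ^ (2 + a) * (2 + a) ^ (2 + a))
  scaledExpℕ-[2+a]*a-≤ a j e m+e≡y = begin
    S * e * T                   ≤⟨ *-monoˡ-≤ T (scaledExpℕ-≤ y (j + suc a) e m+e≡y) ⟩
    y ^ suc (j + suc a) * T     ≡⟨ cong (λ i → y ^ i * T) (+-suc j (suc a)) ⟨
    y ^ (j + n) * T             ≡⟨ cong (_* T) (^-distribˡ-+-* y j n) ⟩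
    y ^ j * y ^ n * T           ≡⟨ cong (λ p → y ^ j * p * T) (^-distrib-* n a n) ⟩
    y ^ j * (N * a ^ n) * T     ≡⟨ regroup (y ^ j) N (a ^ n) T ⟩
    y ^ j * N * (a ^ n * T)     ≤⟨ *-monoʳ-≤ (y ^ j * N) (a^[2+a]-≤ a) ⟩
    y ^ j * N * (a * a * N)     ≡⟨ regroup′ (y ^ j) N (a * a) ⟩
    y ^ j * (a * a) * (N * N)   ∎
    where
    open ≤-Reasoning
    n y N S T : ℕ
    n = 2 + a
    y = n * a
    N = n ^ n
    S = scaledExpℕ y (j + suc a)
    T = 4 + 10 * a + 5 * (a * a)
    regroup : ∀ p N A T → p * (N * A) * T ≡ p * N * (A * T)
    regroup = solve-∀
    regroup′ : ∀ p N b → p * N * (b * N) ≡ p * b * (N * N)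
    regroup′ = solve-∀

  polynomial-bound-at-n : ∀ t →
    (2 + t) * (2 + t) * (2 + t) * ((3 + t + (4 + t)) * (3 + t + (4 + t))) ≤
      (1 + t) * (4 + 10 * (2 + t) + 5 * ((2 + t) * (2 + t))) * ((3 + t) * (3 + t))
  polynomial-bound-at-n t = ≤-trans (m≤m+n _ _) (≤-reflexive (expand t))
    where
    expand : ∀ t →
      (2 + t) * (2 + t) * (2 + t) * ((3 + t + (4 + t)) * (3 + t + (4 + t)))
        + (4 + 118 * t + 141 * (t * t) + 64 * (t * t * t) + 13 * (t * t * t * t) + t * t * t * t * t)
        ≡ (1 + t) * (4 + 10 * (2 + t) + 5 * ((2 + t) * (2 + t))) * ((3 + t) * (3 + t))
    expand = solve-∀

  polynomial-bound-at-n∸1 : ∀ t →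
    4 * ((4 + t) * (4 + t)) * ((6 + t) * (6 + t)) ≤
      (19 + 9 * t + t * t) * (4 + 10 * (4 + t) + 5 * ((4 + t) * (4 + t)))
  polynomial-bound-at-n∸1 t = ≤-trans (m≤m+n _ _) (≤-reflexive (expand t))
    where
    expand : ∀ t →
      4 * ((4 + t) * (4 + t)) * ((6 + t) * (6 + t))
        + (52 + 146 * t + 77 * (t * t) + 15 * (t * t * t) + t * t * t * t)
        ≡ (19 + 9 * t + t * t) * (4 + 10 * (4 + t) + 5 * ((4 + t) * (4 + t)))
    expand = solve-∀

  scaledExpℕ≤altScaledExp²-at-n : ∀ t → let n = 4 + t in
    scaledExpℕ (n * (n ∸ 2)) n ≤ altScaledExp n n * altScaledExp n n
  scaledExpℕ≤altScaledExp²-at-n t = *-cancelʳ-≤ S (g * g) (e * T * (h * h)) (begin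
    S * (e * T * (h * h))                   ≡⟨ identity₁ S e T (h * h) ⟩
    S * e * T * (h * h)                     ≤⟨ *-monoˡ-≤ (h * h) (scaledExpℕ-[2+a]*a-≤ a 1 e n+e≡y) ⟩
    y ^ 1 * (a * a) * (N * N) * (h * h)     ≡⟨ identity₂ n a N h ⟩
    n * (N * N) * (a * a * a * (h * h))     ≤⟨ *-monoʳ-≤ (n * (N * N)) (polynomial-bound-at-n t) ⟩
    n * (N * N) * ((1 + t) * T * (k * k))   ≡⟨ identity₃ n N t T k ⟩
    e * T * (k * N * (k * N))               ≤⟨ *-monoʳ-≤ (e * T) (*-mono-≤ lower lower) ⟩
    e * T * (h * g * (h * g))               ≡⟨ identity₄ e T h g ⟩
    g * g * (e * T * (h * h))               ∎)
    where
    open ≤-Reasoning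
    a n k h y N e T g S : ℕ
    a = 2 + t
    n = 2 + a
    k = 1 + a
    h = k + n
    y = n * a
    N = n ^ n
    e = n * (1 + t)
    T = 4 + 10 * a + 5 * (a * a)
    g = altScaledExp n n
    S = scaledExpℕ y n
    n+e≡y : n + e ≡ y
    n+e≡y = sym (*-suc n (1 + t))
    lower : k * N ≤ h * g
    lower = altScaledExp-lower k n ≤-refl
    identity₁ : ∀ S e T H → S * (e * T * H) ≡ S * e * T * H
    identity₁ = solve-∀
    identity₂ : ∀ n a N h → n * a * 1 * (a * a) * (N * N) * (h * h) ≡ n * (N * N) * (a * a * a * (h * h))
    identity₂ = solve-∀
    identity₃ : ∀ n N t T k → n * (N * N) * ((1 + t) * T * (k * k)) ≡ n * (1 + t) * T * (k * N * (k * N))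
    identity₃ = solve-∀
    identity₄ : ∀ e T h g → e * T * (h * g * (h * g)) ≡ g * g * (e * T * (h * h))
    identity₄ = solve-∀

  scaledExpℕ≤altScaledExp²-at-n∸1 : ∀ t → let n = 6 + t in
    scaledExpℕ (n * (n ∸ 2)) (n ∸ 1) ≤ altScaledExp n (n ∸ 1) * altScaledExp n (n ∸ 1)
  scaledExpℕ≤altScaledExp²-at-n∸1 t = *-cancelʳ-≤ S (g * g) (e * T) (begin
    S * (e * T)                         ≡⟨ *-assoc S e T ⟨
    S * e * T                           ≤⟨ scaledExpℕ-[2+a]*a-≤ a 0 e (1+a+e≡n*a t) ⟩
    1 * (a * a) * (n * M * (n * M))     ≡⟨ identity₁ a n M ⟩
    a * a * (n * n) * (M * M)           ≤⟨ *-monoʳ-≤ (a * a * (n * n)) (*-mono-≤ M≤2g M≤2g) ⟩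
    a * a * (n * n) * (2 * g * (2 * g)) ≡⟨ identity₂ a n g ⟩
    4 * (a * a) * (n * n) * (g * g)     ≤⟨ *-monoˡ-≤ (g * g) (polynomial-bound-at-n∸1 t) ⟩
    e * T * (g * g)                     ≡⟨ *-comm (e * T) (g * g) ⟩
    g * g * (e * T)                     ∎)
    where
    open ≤-Reasoning
    a n M e T g S : ℕ
    a = 4 + t
    n = 2 + a
    M = n ^ suc a
    e = 19 + 9 * t + t * t
    T = 4 + 10 * a + 5 * (a * a)
    g = altScaledExp n (suc a)
    S = scaledExpℕ (n * a) (suc a)
    1+a+e≡n*a : ∀ t → 5 + t + (19 + 9 * t + t * t) ≡ (6 + t) * (4 + t)
    1+a+e≡n*a = solve-∀
    M≤2g : M ≤ 2 * g
    M≤2g = *-cancelˡ-≤ (suc a)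
      (≤-trans (altScaledExp-lower (suc a) (suc a) (n≤1+n _)) (≤-reflexive (double (suc a) g)))
      where
      double : ∀ k g → (k + k) * g ≡ k * (2 * g)
      double = solve-∀
    identity₁ : ∀ a n M → 1 * (a * a) * (n * M * (n * M)) ≡ a * a * (n * n) * (M * M)
    identity₁ = solve-∀
    identity₂ : ∀ a n g → a * a * (n * n) * (2 * g * (2 * g)) ≡ 4 * (a * a) * (n * n) * (g * g)
    identity₂ = solve-∀

  scaledExpℕ≤altScaledExp² : ∀ n m → 2 ≤ n → m ≡ n ∸ 1 ⊎ m ≡ n →
    scaledExpℕ (n * (n ∸ 2)) m ≤ altScaledExp n m * altScaledExp n m
  scaledExpℕ≤altScaledExp² 1 _ (s≤s ()) _
  scaledExpℕ≤altScaledExp² 2 _ _ (inj₁ refl) = ≤ᵇ⇒≤ _ _ _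
  scaledExpℕ≤altScaledExp² 3 _ _ (inj₁ refl) = ≤ᵇ⇒≤ _ _ _
  scaledExpℕ≤altScaledExp² 4 _ _ (inj₁ refl) = ≤ᵇ⇒≤ _ _ _
  scaledExpℕ≤altScaledExp² 5 _ _ (inj₁ refl) = ≤ᵇ⇒≤ _ _ _
  scaledExpℕ≤altScaledExp² (suc (suc (suc (suc (suc (suc t)))))) _ _ (inj₁ refl) =
    scaledExpℕ≤altScaledExp²-at-n∸1 t
  scaledExpℕ≤altScaledExp² 2 _ _ (inj₂ refl) = ≤ᵇ⇒≤ _ _ _
  scaledExpℕ≤altScaledExp² 3 _ _ (inj₂ refl) = ≤ᵇ⇒≤ _ _ _
  scaledExpℕ≤altScaledExp² (suc (suc (suc (suc t)))) _ _ (inj₂ refl) = scaledExpℕ≤altScaledExp²-at-n t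

module IntegerScaledExp where
  open import Data.Nat as ℕ using (ℕ; zero; suc; NonZero)
  open import Data.Nat.Properties using (≤-trans; n≤1+n)
  open import Data.Integer using (ℤ; +_; -_; _+_; _*_; _^_; 1ℤ; -1ℤ)
  open import Data.Integer.Properties using (pos-+; pos-*; *-identityˡ)
  open import Data.Integer.Tactic.RingSolver using (solve-∀)
  open import Relation.Binary.PropositionalEquality
  open ScaledExpSums

  scaledExp : ℕ → ℤ → ℤ
  scaledExp zero    x = 1ℤ
  scaledExp (suc m) x = x ^ suc m + + suc m * scaledExp m x

  pos-^ : ∀ m k → + (m ℕ.^ k) ≡ (+ m) ^ k
  pos-^ m zero    = refl
  pos-^ m (suc k) = trans (pos-* m (m ℕ.^ k)) (cong (+ m *_) (pos-^ m k))

  neg-^ : ∀ i k → (- i) ^ k ≡ -1ℤ ^ k * i ^ k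
  neg-^ i zero    = refl
  neg-^ i (suc k) = trans (cong (- i *_) (neg-^ i k)) (identity i (-1ℤ ^ k) (i ^ k))
    where
    identity : ∀ i s p → - i * (s * p) ≡ -1ℤ * s * (i * p)
    identity = solve-∀

  -1^k*-1^k≡1 : ∀ k → -1ℤ ^ k * -1ℤ ^ k ≡ 1ℤ
  -1^k*-1^k≡1 zero    = refl
  -1^k*-1^k≡1 (suc k) = trans (identity (-1ℤ ^ k)) (-1^k*-1^k≡1 k)
    where
    identity : ∀ s → -1ℤ * s * (-1ℤ * s) ≡ s * s
    identity = solve-∀

  scaledExp-pos : ∀ m y → scaledExp m (+ y) ≡ + scaledExpℕ y m
  scaledExp-pos zero    y = refl
  scaledExp-pos (suc m) y = begin
    (+ y) ^ suc m + + suc m * scaledExp m (+ y)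
      ≡⟨ cong₂ (λ p s → p + + suc m * s) (pos-^ y (suc m)) (sym (scaledExp-pos m y)) ⟨
    + (y ℕ.^ suc m) + + suc m * + scaledExpℕ y m
      ≡⟨ cong (_+_ (+ (y ℕ.^ suc m))) (pos-* (suc m) (scaledExpℕ y m)) ⟨
    + (y ℕ.^ suc m) + + (suc m ℕ.* scaledExpℕ y m)
      ≡⟨ pos-+ (y ℕ.^ suc m) _ ⟨
    + scaledExpℕ y (suc m)
      ∎
    where open ≡-Reasoning

  scaledExp-neg : ∀ k .{{_ : NonZero k}} m → m ℕ.≤ suc k →
    scaledExp m (- + suc k) ≡ -1ℤ ^ m * + altScaledExp (suc k) m
  scaledExp-neg k zero    _     = refl
  scaledExp-neg k (suc m) 1+m≤n = begin
    (- + n) ^ suc m + + suc m * scaledExp m (- + n)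
      ≡⟨ cong₂ (λ p s → p + + suc m * s) (neg-^ (+ n) (suc m)) (scaledExp-neg k m m≤n) ⟩
    -1ℤ ^ suc m * (+ n) ^ suc m + + suc m * (s * + g)
      ≡⟨ cong (λ p → -1ℤ ^ suc m * p + + suc m * (s * + g)) (sym (pos-^ n (suc m))) ⟩
    -1ℤ ^ suc m * + (n ℕ.^ suc m) + + suc m * (s * + g)
      ≡⟨ cong (λ p → -1ℤ ^ suc m * + p + + suc m * (s * + g)) (sym (altScaledExp-recurrence k m m≤n)) ⟩
    -1ℤ ^ suc m * + (g′ ℕ.+ suc m ℕ.* g) + + suc m * (s * + g)
      ≡⟨ cong (λ p → -1ℤ ^ suc m * p + + suc m * (s * + g)) g′+[1+m]*g ⟩
    -1ℤ * s * (+ g′ + + suc m * + g) + + suc m * (s * + g)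
      ≡⟨ identity s (+ g′) (+ suc m) (+ g) ⟩
    -1ℤ ^ suc m * + g′ ∎
    where
    open ≡-Reasoning
    n g g′ : ℕ
    n = suc k
    g = altScaledExp n m
    g′ = altScaledExp n (suc m)
    s : ℤ
    s = -1ℤ ^ m
    m≤n : m ℕ.≤ n
    m≤n = ≤-trans (n≤1+n m) 1+m≤n
    g′+[1+m]*g : + (g′ ℕ.+ suc m ℕ.* g) ≡ + g′ + + suc m * + g
    g′+[1+m]*g = trans (pos-+ g′ _) (cong (_+_ (+ g′)) (pos-* (suc m) g))
    identity : ∀ s g′ c g → -1ℤ * s * (g′ + c * g) + c * (s * g) ≡ -1ℤ * s * g′
    identity = solve-∀

  scaledExp-neg² : ∀ k .{{_ : NonZero k}} m → m ℕ.≤ suc k →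
    scaledExp m (- + suc k) * scaledExp m (- + suc k) ≡ + (altScaledExp (suc k) m ℕ.* altScaledExp (suc k) m)
  scaledExp-neg² k m m≤n = begin
    scaledExp m (- + suc k) * scaledExp m (- + suc k) ≡⟨ cong (λ F → F * F) (scaledExp-neg k m m≤n) ⟩
    s * + g * (s * + g)                               ≡⟨ identity s (+ g) ⟩
    s * s * (+ g * + g)                               ≡⟨ cong (_* (+ g * + g)) (-1^k*-1^k≡1 m) ⟩
    1ℤ * (+ g * + g)                                  ≡⟨ *-identityˡ (+ g * + g) ⟩
    + g * + g                                         ≡⟨ pos-* g g ⟨
    + (g ℕ.* g)                                       ∎
    where
    open ≡-Reasoning
    s : ℤ
    s = -1ℤ ^ m
    g : ℕ
    g = altScaledExp (suc k) m
    identity : ∀ s g → s * g * (s * g) ≡ s * s * (g * g)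
    identity = solve-∀

module Fractions where
  open import Defs
  open import Data.Nat as ℕ using (ℕ; zero; suc; NonZero; _!)
  open import Data.Nat.Properties using (m*n≢0; _!≢0)
  open import Data.Integer as ℤ using (ℤ; +_; 1ℤ)
  open import Data.Integer.Properties using (*-monoʳ-≤-nonNeg; pos-*)
  open import Data.Integer.Tactic.RingSolver using (solve-∀)
  open import Data.Rational using (ℚ; _/_; _+_; _*_; _≤_; toℚᵘ)
  open import Data.Rational.Properties
    using (toℚᵘ-fromℚᵘ; fromℚᵘ-cong; toℚᵘ-injective; toℚᵘ-homo-+; toℚᵘ-homo-*; toℚᵘ-cancel-≤)
  import Data.Rational.Unnormalised as ℚᵘ
  import Data.Rational.Unnormalised.Properties as ℚᵘ
  open import Relation.Binary.PropositionalEquality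
  open IntegerScaledExp

  -- NonZero (m * n) is passed explicitly: declaring m*n≢0 as an instance makes instance search blow up.

  toℚᵘ-/ : ∀ i d .{{_ : NonZero d}} → toℚᵘ (i / d) ℚᵘ.≃ i ℚᵘ./ d
  toℚᵘ-/ i (suc d) = toℚᵘ-fromℚᵘ (ℚᵘ.mkℚᵘ i d)

  /-≡ : ∀ {i j b d} .{{_ : NonZero b}} .{{_ : NonZero d}} →
        i ℤ.* + d ≡ j ℤ.* + b → i / b ≡ j / d
  /-≡ {i} {j} {suc b} {suc d} eq = fromℚᵘ-cong {ℚᵘ.mkℚᵘ i b} {ℚᵘ.mkℚᵘ j d} (ℚᵘ.*≡* eq)

  /-+-/ : ∀ i j b d .{{_ : NonZero b}} .{{_ : NonZero d}} →
          i / b + j / d ≡ _/_ (i ℤ.* + d ℤ.+ j ℤ.* + b) (b ℕ.* d) {{m*n≢0 b d}}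
  /-+-/ i j b@(suc _) d@(suc _) = toℚᵘ-injective (ℚᵘ.≃-trans (toℚᵘ-homo-+ (i / b) (j / d))
    (ℚᵘ.≃-trans (ℚᵘ.+-cong (toℚᵘ-/ i b) (toℚᵘ-/ j d)) (ℚᵘ.≃-sym (toℚᵘ-/ _ (b ℕ.* d) {{m*n≢0 b d}}))))

  /-*-/ : ∀ i j b d .{{_ : NonZero b}} .{{_ : NonZero d}} →
          (i / b) * (j / d) ≡ _/_ (i ℤ.* j) (b ℕ.* d) {{m*n≢0 b d}}
  /-*-/ i j b@(suc _) d@(suc _) = toℚᵘ-injective (ℚᵘ.≃-trans (toℚᵘ-homo-* (i / b) (j / d))
    (ℚᵘ.≃-trans (ℚᵘ.*-cong (toℚᵘ-/ i b) (toℚᵘ-/ j d)) (ℚᵘ.≃-sym (toℚᵘ-/ _ (b ℕ.* d) {{m*n≢0 b d}}))))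

  /-monoˡ-≤ : ∀ d .{{_ : NonZero d}} {i j} → i ℤ.≤ j → i / d ≤ j / d
  /-monoˡ-≤ d@(suc _) {i} {j} i≤j = toℚᵘ-cancel-≤
    (ℚᵘ.≤-respʳ-≃ (ℚᵘ.≃-sym (toℚᵘ-/ j d)) (ℚᵘ.≤-respˡ-≃ (ℚᵘ.≃-sym (toℚᵘ-/ i d))
      (ℚᵘ.*≤* (*-monoʳ-≤-nonNeg (+ d) i≤j))))

  i/d+j/[c*d]≡[j+c*i]/[c*d] : ∀ i j c d .{{_ : NonZero c}} .{{_ : NonZero d}} →
    i / d + _/_ j (c ℕ.* d) {{m*n≢0 c d}} ≡ _/_ (j ℤ.+ + c ℤ.* i) (c ℕ.* d) {{m*n≢0 c d}}
  i/d+j/[c*d]≡[j+c*i]/[c*d] i j c d =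
    trans (/-+-/ i j d (c ℕ.* d))
      (/-≡ {i ℤ.* + (c ℕ.* d) ℤ.+ j ℤ.* + d} {j ℤ.+ + c ℤ.* i} cross-multiplied)
    where
    instance
      c*d≢0 : NonZero (c ℕ.* d)
      c*d≢0 = m*n≢0 c d
      d*[c*d]≢0 : NonZero (d ℕ.* (c ℕ.* d))
      d*[c*d]≢0 = m*n≢0 d (c ℕ.* d)
    identity : ∀ i j c d →
      (i ℤ.* (c ℤ.* d) ℤ.+ j ℤ.* d) ℤ.* (c ℤ.* d) ≡ (j ℤ.+ c ℤ.* i) ℤ.* (d ℤ.* (c ℤ.* d))
    identity = solve-∀
    cross-multiplied :
      (i ℤ.* + (c ℕ.* d) ℤ.+ j ℤ.* + d) ℤ.* + (c ℕ.* d) ≡ (j ℤ.+ + c ℤ.* i) ℤ.* + (d ℕ.* (c ℕ.* d))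
    cross-multiplied = begin
      (i ℤ.* + (c ℕ.* d) ℤ.+ j ℤ.* + d) ℤ.* + (c ℕ.* d)
        ≡⟨ cong (λ e → (i ℤ.* e ℤ.+ j ℤ.* + d) ℤ.* e) (pos-* c d) ⟩
      (i ℤ.* (+ c ℤ.* + d) ℤ.+ j ℤ.* + d) ℤ.* (+ c ℤ.* + d)
        ≡⟨ identity i j (+ c) (+ d) ⟩
      (j ℤ.+ + c ℤ.* i) ℤ.* (+ d ℤ.* (+ c ℤ.* + d))
        ≡⟨ cong ((j ℤ.+ + c ℤ.* i) ℤ.*_) d*[c*d] ⟨
      (j ℤ.+ + c ℤ.* i) ℤ.* + (d ℕ.* (c ℕ.* d))
        ∎
      where
      open ≡-Reasoning
      d*[c*d] : + (d ℕ.* (c ℕ.* d)) ≡ + d ℤ.* (+ c ℤ.* + d)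
      d*[c*d] = trans (pos-* d (c ℕ.* d)) (cong (+ d ℤ.*_) (pos-* c d))

  d/1*[i/d*j/d]≡i*j/d : ∀ d .{{_ : NonZero d}} i j → (+ d / 1) * ((i / d) * (j / d)) ≡ (i ℤ.* j) / d
  d/1*[i/d*j/d]≡i*j/d d i j = begin
    (+ d / 1) * ((i / d) * (j / d))           ≡⟨ cong ((+ d / 1) *_) (/-*-/ i j d d) ⟩
    (+ d / 1) * ((i ℤ.* j) / (d ℕ.* d))       ≡⟨ /-*-/ (+ d) (i ℤ.* j) 1 (d ℕ.* d) ⟩
    (+ d ℤ.* (i ℤ.* j)) / (1 ℕ.* (d ℕ.* d))   ≡⟨ /-≡ {+ d ℤ.* (i ℤ.* j)} {i ℤ.* j} cross-multiplied ⟩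
    (i ℤ.* j) / d                             ∎
    where
    open ≡-Reasoning
    instance
      d*d≢0 : NonZero (d ℕ.* d)
      d*d≢0 = m*n≢0 d d
      1*[d*d]≢0 : NonZero (1 ℕ.* (d ℕ.* d))
      1*[d*d]≢0 = m*n≢0 1 (d ℕ.* d)
    identity : ∀ d p → d ℤ.* p ℤ.* d ≡ p ℤ.* (1ℤ ℤ.* (d ℤ.* d))
    identity = solve-∀
    cross-multiplied : + d ℤ.* (i ℤ.* j) ℤ.* + d ≡ (i ℤ.* j) ℤ.* + (1 ℕ.* (d ℕ.* d))
    cross-multiplied = begin
      + d ℤ.* (i ℤ.* j) ℤ.* + d              ≡⟨ identity (+ d) (i ℤ.* j) ⟩
      (i ℤ.* j) ℤ.* (1ℤ ℤ.* (+ d ℤ.* + d))   ≡⟨ cong (λ e → (i ℤ.* j) ℤ.* (1ℤ ℤ.* e)) (pos-* d d) ⟨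
      (i ℤ.* j) ℤ.* (1ℤ ℤ.* + (d ℕ.* d))     ≡⟨ cong ((i ℤ.* j) ℤ.*_) (pos-* 1 (d ℕ.* d)) ⟨
      (i ℤ.* j) ℤ.* + (1 ℕ.* (d ℕ.* d))      ∎

  expTrunc≡scaledExp/! : ∀ m x → expTrunc m x ≡ _/_ (scaledExp m x) (m !) {{m !≢0}}
  expTrunc≡scaledExp/! zero    x = refl
  expTrunc≡scaledExp/! (suc m) x =
    trans (cong (_+ newTerm) (expTrunc≡scaledExp/! m x))
      (i/d+j/[c*d]≡[j+c*i]/[c*d] (scaledExp m x) (x ℤ.^ suc m) (suc m) (m !))
    where
    newTerm : ℚ
    newTerm = _/_ (x ℤ.^ suc m) (suc m !) {{suc m !≢0}}
    instance
      m!≢0 : NonZero (m !)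
      m!≢0 = m !≢0

open import Defs
open MainEstimate
open IntegerScaledExp
open Fractions
open import Data.Nat as ℕ using (ℕ; _≤_; _∸_; _!; suc; s≤s; NonZero)
open import Data.Nat.Properties using (_!≢0; ≤-reflexive; m∸n≤m)
open import Data.Sum using (_⊎_; [_,_])
open import Relation.Binary.PropositionalEquality using (_≡_; sym; trans; cong; subst; subst₂)
open import Data.Integer using (ℤ; +_; -_; +≤+) renaming (_*_ to _*ℤ_; _-_ to _-ℤ_; _≤_ to _≤ℤ_)
open import Data.Integer.Properties using (pos-*)
open import Data.Rational using (_*_; _/_) renaming (_≤_ to _≤ℚ_)
open import Data.Rational.Properties using (module ≤-Reasoning)

lemmaB3 : (n m : ℕ) → 2 ≤ n → (m ≡ n ∸ 1 ⊎ m ≡ n) →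
    expTrunc m ((+ n) *ℤ ((+ n) -ℤ (+ 2))) ≤ℚ
    ((+ (m !)) / 1 * (expTrunc m (- (+ n)) * expTrunc m (- (+ n))))
lemmaB3 1 _ (s≤s ()) _
lemmaB3 n@(suc (suc a)) m 2≤n m≡n∸1⊎m≡n = begin
  expTrunc m (+ n *ℤ + a)
    ≡⟨ expTrunc≡scaledExp/! m (+ n *ℤ + a) ⟩
  scaledExp m (+ n *ℤ + a) / m !
    ≤⟨ /-monoˡ-≤ (m !) scaledExp-≤ ⟩
  (F *ℤ F) / m !
    ≡⟨ d/1*[i/d*j/d]≡i*j/d (m !) F F ⟨
  (+ (m !)) / 1 * ((F / m !) * (F / m !))
    ≡⟨ cong (λ E → (+ (m !)) / 1 * (E * E)) (expTrunc≡scaledExp/! m (- + n)) ⟨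
  (+ (m !)) / 1 * (expTrunc m (- (+ n)) * expTrunc m (- (+ n)))
    ∎
  where
  open ≤-Reasoning
  instance
    m!≢0 : NonZero (m !)
    m!≢0 = m !≢0
  F : ℤ
  F = scaledExp m (- + n)
  m≤n : m ≤ n
  m≤n = [ (λ m≡n∸1 → subst (_≤ n) (sym m≡n∸1) (m∸n≤m n 1)) , ≤-reflexive ] m≡n∸1⊎m≡n
  scaledExp-≤ : scaledExp m (+ n *ℤ + a) ≤ℤ F *ℤ F
  scaledExp-≤ = subst₂ _≤ℤ_
    (trans (sym (scaledExp-pos m (n ℕ.* a))) (cong (scaledExp m) (pos-* n a)))
    (sym (scaledExp-neg² (suc a) m m≤n))
    (+≤+ (scaledExpℕ≤altScaledExp² n m 2≤n m≡n∸1⊎m≡n))
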